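{- Let $G=(V,E)$ be a graph whose vertex set is partitioned into three (possibly empty) cliques $Q_1,Q_2,Q_3$ such that: (a) for all distinct $i,j\in\{1,2,3\}$, each vertex of $Q_i$ is adjacent to at most one vertex of $Q_j$; (b) for distinct $i,j,k\in\{1,2,3\}$, if a vertex of $Q_i$ is adjacent to $b\in Q_j$ and to $c\in Q_k$, then $bc\in E$; (c) for each $i\in\{1,2,3\}$ there is a set of colors $L_i$ such that (i) every vertex $v\in Q_i$ has list $L(v)=L_i$; (ii) $|L_i|\ge |Q_i|$; (iii) each $L_i$ contains a color $d_i$ such that $d_1,d_2,d_3$ are pairwise distinct; (iv) no color belongs to all three of $L_1,L_2,L_3$. Then $G$ admits an $L$-coloring, i.e., a proper vertex coloring of $G$ in which every vertex $v$ receives a color from $L(v)$ (so vertices of $Q_i$ receive colors from $L_i$).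
   Context: All graphs are finite and simple. A proper coloring assigns colors to vertices so that adjacent vertices receive different colors. -}

module Defs where

open import Data.Nat using (ℕ; _≤_)
open import Data.Fin using (Fin)
open import Data.Fin.Properties using (_≟_)
open import Data.List using (List; length; filter)
open import Data.List.Base using (allFin)
open import Data.List.Membership.Propositional using (_∈_)
open import Data.Product using (Σ; _×_)
open import Relation.Binary.PropositionalEquality using (_≡_; _≢_)
open import Relation.Nullary using (¬_)
open import Relation.Binary.Definitions using (Decidable)

record SimpleGraph (n : ℕ) : Set₁ where
  field
    Adj     : Fin n → Fin n → Set
    sym     : ∀ {u v} → Adj u v → Adj v u
    irrefl  : ∀ {u} → ¬ Adj u u
    adj?    : Decidable Adj
open SimpleGraph public

Part : ∀ {n} → (Fin n → Fin 3) → Fin 3 → List (Fin n)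
Part {n} part i = filter (λ v → part v ≟ i) (allFin n)

PartsAreCliques : ∀ {n} → SimpleGraph n → (Fin n → Fin 3) → Set
PartsAreCliques G part = ∀ u v → part u ≡ part v → u ≢ v → Adj G u v

CondA : ∀ {n} → SimpleGraph n → (Fin n → Fin 3) → Set
CondA G part = ∀ u b b' → part u ≢ part b → part b ≡ part b' →
               Adj G u b → Adj G u b' → b ≡ b'

CondB : ∀ {n} → SimpleGraph n → (Fin n → Fin 3) → Set
CondB G part = ∀ u b c → part u ≢ part b → part u ≢ part c → part b ≢ part c →
               Adj G u b → Adj G u c → Adj G b c

LColoring : ∀ {n} → SimpleGraph n → (Fin n → Fin 3) → (Fin 3 → List ℕ) → Set
LColoring {n} G part L =
  Σ (Fin n → ℕ) λ col →
    (∀ v → col v ∈ L (part v)) × (∀ u v → Adj G u v → col u ≢ col v)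

-- The parts are then relabelled so that |L₁| ≤ |L₂| ≤ |L₃|
-- (`sortFin3`) and coloured one after another by this lemma (`ThreeCliqueColouring`):
--   Q₁ freely;
--   Q₂ avoiding the colour of its (by (a) unique) Q₁-neighbour and, when |L₃| ≤ 2,
--      all of L₃ if a Q₃-neighbour already sees a colour of L₃ in Q₁ (`Reserved`);
--   Q₃ avoiding the colours of its Q₁- and Q₂-neighbours.
-- Condition (a) bounds the victims of each colour, (b) and the absence of a colour
-- common to all lists rule out the remaining conflicts, and d₁, d₂, d₃ serve the
-- parts whose lists are too short for counting.
module Submission where

open import Defs
open import Data.Nat using (ℕ; _≤_; _<_; z≤n; s≤s; _≤?_)
open import Data.Nat.Properties using (≤-trans; ≤-pred; ≰⇒>; ≤-total) renaming (_≟_ to _≟ℕ_)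
open import Data.Fin using (Fin; zero; suc)
open import Data.Fin.Properties using (all?) renaming (_≟_ to _≟F_; any? to anyFin?)
open import Data.List using (List; []; _∷_; length; filter; allFin)
open import Data.List.Membership.Propositional using (_∈_; find; lose)
open import Data.List.Membership.Propositional.Properties using (∈-filter⁺; ∈-filter⁻; ∈-allFin)
open import Data.List.Membership.DecPropositional _≟ℕ_ using (_∈?_)
open import Data.List.Properties using (filter-notAll)
open import Data.List.Relation.Unary.All as All using (All; []; _∷_)
open import Data.List.Relation.Unary.All.Properties using (¬All⇒Any¬)
open import Data.List.Relation.Unary.Any as Any using (Any; here; there)
open import Data.List.Relation.Unary.AllPairs using (_∷_)
open import Data.List.Relation.Unary.Unique.Propositional using (Unique)
open import Data.List.Relation.Unary.Unique.Propositional.Properties using (filter⁺; allFin⁺)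
open import Data.Empty using (⊥; ⊥-elim)
open import Data.Product using (Σ; _×_; _,_; proj₁; proj₂)
open import Data.Sum using (_⊎_; inj₁; inj₂)
open import Function using (id)
open import Relation.Nullary using (¬_; Dec; yes; no)
open import Relation.Nullary.Decidable using (¬?; _×-dec_; _⊎-dec_; True; toWitness)
open import Relation.Binary.Definitions using (DecidableEquality)
open import Relation.Binary.PropositionalEquality
  using (_≡_; _≢_; refl; trans; subst; cong; ≢-sym) renaming (sym to ≡-sym)

someFails : ∀ {A : Set} {P : A → Set} → (∀ x → Dec (P x)) → {xs : List A} →
            ¬ All P xs → Σ A λ x → x ∈ xs × ¬ P x
someFails P? {xs} ¬all = find (¬All⇒Any¬ P? xs ¬all)

avoidOne : ∀ {A : Set} {P : A → Set} → (∀ x → Dec (P x)) → {xs : List A} →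
           Unique xs → 2 ≤ length xs →
           (∀ {x y} → x ∈ xs → y ∈ xs → P x → P y → x ≡ y) →
           Σ A λ x → x ∈ xs × ¬ P x
avoidOne P? {a ∷ b ∷ _} ((a≢b ∷ _) ∷ _) _ atMostOne =
  someFails P? λ { (pa ∷ pb ∷ _) → a≢b (atMostOne (here refl) (there (here refl)) pa pb) }
avoidOne P? {[]} _ ()
avoidOne P? {_ ∷ []} _ (s≤s ())

avoidTwo : ∀ {A : Set} {P Q : A → Set} → (∀ x → Dec (P x)) → (∀ x → Dec (Q x)) →
           {xs : List A} → Unique xs → 3 ≤ length xs →
           (∀ {x y} → P x → P y → x ≡ y) → (∀ {x y} → Q x → Q y → x ≡ y) →
           Σ A λ x → x ∈ xs × ¬ (P x ⊎ Q x)
avoidTwo {P = P} {Q} P? Q? {a ∷ b ∷ e ∷ _} ((a≢b ∷ a≢e ∷ _) ∷ (b≢e ∷ _) ∷ _) _ oneP oneQ =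
  someFails (λ x → P? x ⊎-dec Q? x) λ { (fa ∷ fb ∷ fe ∷ _) → clash fa fb fe }
  where
    -- two of three values in P ∪ Q lie in the same one of P, Q, so they coincide
    clash : (P a ⊎ Q a) → (P b ⊎ Q b) → (P e ⊎ Q e) → ⊥
    clash (inj₁ pa) (inj₁ pb) _         = a≢b (oneP pa pb)
    clash (inj₂ qa) (inj₂ qb) _         = a≢b (oneQ qa qb)
    clash (inj₁ pa) (inj₂ _)  (inj₁ pe) = a≢e (oneP pa pe)
    clash (inj₁ _)  (inj₂ qb) (inj₂ qe) = b≢e (oneQ qb qe)
    clash (inj₂ _)  (inj₁ pb) (inj₁ pe) = b≢e (oneP pb pe)
    clash (inj₂ qa) (inj₁ _)  (inj₂ qe) = a≢e (oneQ qa qe)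
avoidTwo P? Q? {[]} _ ()
avoidTwo P? Q? {_ ∷ []} _ (s≤s ())
avoidTwo P? Q? {_ ∷ _ ∷ []} _ (s≤s (s≤s ()))

noMember : ∀ {A : Set} {xs : List A} {x} → length xs ≤ 0 → x ∈ xs → ⊥
noMember {xs = _ ∷ _} () _

atMostOneMember : ∀ {A : Set} {xs : List A} {x y} → length xs ≤ 1 → x ∈ xs → y ∈ xs → x ≡ y
atMostOneMember {xs = _ ∷ []} _ (here refl) (here refl) = refl
atMostOneMember {xs = _ ∷ []} _ (here _) (there ())
atMostOneMember {xs = _ ∷ []} _ (there ()) _
atMostOneMember {xs = _ ∷ _ ∷ _} (s≤s ()) _ _

coincide : ∀ {A : Set} {xs : List A} {x y z} → length xs ≤ 2 →
           x ∈ xs → y ∈ xs → z ∈ xs → x ≢ z → y ≢ z → x ≡ y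
coincide {xs = _ ∷ _} _       (here refl) (here refl) _           _   _   = refl
coincide {xs = _ ∷ _} (s≤s l) (there x∈)  (there y∈)  _           _   _   = atMostOneMember l x∈ y∈
coincide {xs = _ ∷ _} _       (here refl) (there _)   (here refl) x≢z _   = ⊥-elim (x≢z refl)
coincide {xs = _ ∷ _} (s≤s l) (here refl) (there y∈)  (there z∈)  _   y≢z = ⊥-elim (y≢z (atMostOneMember l y∈ z∈))
coincide {xs = _ ∷ _} _       (there _)   (here refl) (here refl) _   y≢z = ⊥-elim (y≢z refl)
coincide {xs = _ ∷ _} (s≤s l) (there x∈)  (here refl) (there z∈)  x≢z _   = ⊥-elim (x≢z (atMostOneMember l x∈ z∈))

module DistinctChoice {V : Set} (_≟V_ : DecidableEquality V)
                      (Forbidden : V → ℕ → Set) (forbidden? : ∀ v c → Dec (Forbidden v c)) where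

  Choice : List ℕ → List V → (V → ℕ) → Set
  Choice L vs f = (∀ {v} → v ∈ vs → f v ∈ L × ¬ Forbidden v (f v)) ×
                  (∀ {v v'} → v ∈ vs → v' ∈ vs → f v ≡ f v' → v ≡ v')

  OneVictim : List ℕ → List V → Set
  OneVictim L vs = ∀ {c v v'} → c ∈ L → v ∈ vs → v' ∈ vs → Forbidden v c → Forbidden v' c → v ≡ v'

  HasAllowed : List ℕ → List V → Set
  HasAllowed L vs = ∀ {v} → v ∈ vs → Σ ℕ λ c → c ∈ L × ¬ Forbidden v c

  without : V → List V → List V
  without x = filter (λ v → ¬? (v ≟V x))

  without⁻ : ∀ {x v vs} → v ∈ without x vs → v ∈ vs × v ≢ x
  without⁻ {x} = ∈-filter⁻ (λ v → ¬? (v ≟V x))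

  without⁺ : ∀ {x v vs} → v ∈ vs → v ≢ x → v ∈ without x vs
  without⁺ {x} = ∈-filter⁺ (λ v → ¬? (v ≟V x))

  without-shorter : ∀ {x vs} → x ∈ vs → length (without x vs) < length vs
  without-shorter {x} {vs} x∈ =
    filter-notAll (λ v → ¬? (v ≟V x)) vs (Any.map (λ x≡v v≢x → v≢x (≡-sym x≡v)) x∈)

  assign : V → ℕ → (V → ℕ) → V → ℕ
  assign x c g v with v ≟V x
  ... | yes _ = c
  ... | no _  = g v

  assign-choice : ∀ {c L vs x g} → x ∈ vs → ¬ Forbidden x c → All (c ≢_) L →
                  Choice L (without x vs) g → Choice (c ∷ L) vs (assign x c g)
  assign-choice {c} {L} {vs} {x} {g} x∈ allowed c∉L (good , injective) = good' , injective'
    where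
      good' : ∀ {v} → v ∈ vs → assign x c g v ∈ c ∷ L × ¬ Forbidden v (assign x c g v)
      good' {v} v∈ with v ≟V x
      ... | yes refl = here refl , allowed
      ... | no v≢x   = there (proj₁ (good (without⁺ v∈ v≢x))) , proj₂ (good (without⁺ v∈ v≢x))

      notC : ∀ {v} → v ∈ vs → v ≢ x → c ≢ g v
      notC v∈ v≢x = All.lookup c∉L (proj₁ (good (without⁺ v∈ v≢x)))

      injective' : ∀ {v v'} → v ∈ vs → v' ∈ vs → assign x c g v ≡ assign x c g v' → v ≡ v'
      injective' {v} {v'} v∈ v'∈ eq with v ≟V x | v' ≟V x
      ... | yes v≡x | yes v'≡x = trans v≡x (≡-sym v'≡x)
      ... | yes _   | no v'≢x  = ⊥-elim (notC v'∈ v'≢x eq)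
      ... | no v≢x  | yes _    = ⊥-elim (notC v∈ v≢x (≡-sym eq))
      ... | no v≢x  | no v'≢x  = injective (without⁺ v∈ v≢x) (without⁺ v'∈ v'≢x) eq

  -- If y is forbidden every colour of L, no other vertex is: the two would share
  -- a forbidden colour, or, if L is empty, there is no room for a second vertex.
  aloneStuck : ∀ {c L vs y v} → OneVictim (c ∷ L) vs → length vs ≤ length (c ∷ L) →
               y ∈ vs → v ∈ without y vs → All (Forbidden y) L → All (Forbidden v) L → ⊥
  aloneStuck {L = []} _ fits y∈ v∈ _ _ = noMember (≤-pred (≤-trans (without-shorter y∈) fits)) v∈
  aloneStuck {L = _ ∷ _} {vs} {y} oneVictim _ y∈ v∈ (fy ∷ _) (fv ∷ _) =
    proj₂ (without⁻ {vs = vs} v∈) (oneVictim (there (here refl)) (proj₁ (without⁻ {vs = vs} v∈)) y∈ fv fy)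

  atLeastTwo : ∀ {L vs} → ¬ (length vs ≤ length L) → ¬ Any (λ v → All (Forbidden v) L) vs →
               2 ≤ length vs
  atLeastTwo {_}     {[]}        overfull _ = ⊥-elim (overfull z≤n)
  atLeastTwo {[]}    {_ ∷ _}     _ noneStuck = ⊥-elim (noneStuck (here []))
  atLeastTwo {_ ∷ _} {_ ∷ []}    overfull _ = ⊥-elim (overfull (s≤s z≤n))
  atLeastTwo {_}     {_ ∷ _ ∷ _} _ _ = s≤s (s≤s z≤n)

  -- Induction on the colours: the first colour c goes to the vertex that can only
  -- take c, if there is one; otherwise it is dropped if the remaining colours
  -- suffice, and else given to any vertex for which it is allowed.
  distinctChoice : ∀ L → Unique L → ∀ vs → Unique vs → length vs ≤ length L →
                   OneVictim L vs → HasAllowed L vs → Σ (V → ℕ) (Choice L vs)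
  distinctChoice [] _ [] _ _ _ _ = (λ _ → 0) , (λ ()) , (λ ())
  distinctChoice [] _ (_ ∷ _) _ () _ _
  distinctChoice (c ∷ L) (c∉L ∷ uniqueL) vs uniqueVs fits oneVictim hasAllowed =
    byStuck (Any.any? (λ v → All.all? (forbidden? v) L) vs)
    where
      Stuck : V → Set
      Stuck v = All (Forbidden v) L

      oneVictimIn : ∀ {ws} → (∀ {w} → w ∈ ws → w ∈ vs) → OneVictim L ws
      oneVictimIn ws⊆vs c∈ v∈ v'∈ = oneVictim (there c∈) (ws⊆vs v∈) (ws⊆vs v'∈)

      allowedIn : ∀ {v} → ¬ Stuck v → Σ ℕ λ c' → c' ∈ L × ¬ Forbidden v c'
      allowedIn = someFails (forbidden? _)

      cAllowed : ∀ {y} → y ∈ vs → Stuck y → ¬ Forbidden y c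
      cAllowed y∈ stuck with hasAllowed y∈
      ... | _ , here refl , allowed = allowed
      ... | _ , there c'∈ , allowed = ⊥-elim (allowed (All.lookup stuck c'∈))

      giveTo : ∀ x → x ∈ vs → ¬ Forbidden x c → (∀ {v} → v ∈ without x vs → ¬ Stuck v) →
               Σ (V → ℕ) (Choice (c ∷ L) vs)
      giveTo x x∈ allowed unstuck =
        let g , choice = distinctChoice L uniqueL (without x vs)
                           (filter⁺ (λ v → ¬? (v ≟V x)) uniqueVs)
                           (≤-pred (≤-trans (without-shorter x∈) fits))
                           (oneVictimIn (λ v∈ → proj₁ (without⁻ v∈)))
                           (λ v∈ → allowedIn (unstuck v∈))
        in assign x c g , assign-choice x∈ allowed c∉L choice

      byStuck : Dec (Any Stuck vs) → Σ (V → ℕ) (Choice (c ∷ L) vs)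
      byStuck (yes someStuck) =
        let y , y∈ , stuck = find someStuck
        in giveTo y y∈ (cAllowed y∈ stuck) (λ v∈ → aloneStuck oneVictim fits y∈ v∈ stuck)
      byStuck (no noneStuck) with length vs ≤? length L
      ... | yes fitsL =
        let g , good , injective = distinctChoice L uniqueL vs uniqueVs fitsL (oneVictimIn id)
                                     (λ v∈ → allowedIn (λ stuck → noneStuck (lose v∈ stuck)))
        in g , (λ v∈ → there (proj₁ (good v∈)) , proj₂ (good v∈)) , injective
      ... | no overfull =
        let x , x∈ , allowed = avoidOne (λ v → forbidden? v c) uniqueVs
                                 (atLeastTwo overfull noneStuck) (oneVictim (here refl))
        in giveTo x x∈ allowed (λ v∈ stuck → noneStuck (lose (proj₁ (without⁻ v∈)) stuck))

module _ {n} (part : Fin n → Fin 3) where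

  ∈Part⁻ : ∀ {v i} → v ∈ Part part i → part v ≡ i
  ∈Part⁻ {i = i} v∈ = proj₂ (∈-filter⁻ (λ u → part u ≟F i) {xs = allFin n} v∈)

  ∈Part⁺ : ∀ {v i} → part v ≡ i → v ∈ Part part i
  ∈Part⁺ {v} {i} = ∈-filter⁺ (λ u → part u ≟F i) (∈-allFin v)

  record PartColouring (L : Fin 3 → List ℕ) (i : Fin 3) (Forbidden : Fin n → ℕ → Set) : Set where
    field
      colour    : Fin n → ℕ
      colour∈L  : ∀ {u} → part u ≡ i → colour u ∈ L i
      allowed   : ∀ {u} → part u ≡ i → ¬ Forbidden u (colour u)
      injective : ∀ {u u'} → part u ≡ i → part u' ≡ i → colour u ≡ colour u' → u ≡ u'

  colourPart : (L : Fin 3 → List ℕ) (i : Fin 3) → Unique (L i) → length (Part part i) ≤ length (L i) →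
               (Forbidden : Fin n → ℕ → Set) → (∀ u c → Dec (Forbidden u c)) →
               (∀ {c u u'} → c ∈ L i → part u ≡ i → part u' ≡ i →
                  Forbidden u c → Forbidden u' c → u ≡ u') →
               (∀ {u} → part u ≡ i → Σ ℕ λ c → c ∈ L i × ¬ Forbidden u c) →
               PartColouring L i Forbidden
  colourPart L i uniqueL fits Forbidden forbidden? oneVictim hasAllowed =
    let f , good , injective = DistinctChoice.distinctChoice _≟F_ Forbidden forbidden?
                                 (L i) uniqueL (Part part i) uniquePart fits
                                 (λ c∈ u∈ u'∈ → oneVictim c∈ (∈Part⁻ u∈) (∈Part⁻ u'∈))
                                 (λ u∈ → hasAllowed (∈Part⁻ u∈))
    in record { colour    = f
              ; colour∈L  = λ u∈ → proj₁ (good (∈Part⁺ u∈))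
              ; allowed   = λ u∈ → proj₂ (good (∈Part⁺ u∈))
              ; injective = λ u∈ u'∈ → injective (∈Part⁺ u∈) (∈Part⁺ u'∈) }
    where
      uniquePart : Unique (Part part i)
      uniquePart = filter⁺ (λ u → part u ≟F i) (allFin⁺ n)

record SortedEnumeration (size : Fin 3 → ℕ) : Set where
  field
    p₁ p₂ p₃    : Fin 3
    p₁≢p₂       : p₁ ≢ p₂
    p₁≢p₃       : p₁ ≢ p₃
    p₂≢p₃       : p₂ ≢ p₃
    cover       : ∀ i → i ≡ p₁ ⊎ i ≡ p₂ ⊎ i ≡ p₃
    size₁≤size₂ : size p₁ ≤ size p₂
    size₂≤size₃ : size p₂ ≤ size p₃

Enumerates : Fin 3 → Fin 3 → Fin 3 → Set
Enumerates p q r = (p ≢ q × p ≢ r × q ≢ r) × (∀ i → i ≡ p ⊎ i ≡ q ⊎ i ≡ r)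

enumerates? : ∀ p q r → Dec (Enumerates p q r)
enumerates? p q r = (¬? (p ≟F q) ×-dec ¬? (p ≟F r) ×-dec ¬? (q ≟F r))
                    ×-dec all? (λ i → i ≟F p ⊎-dec i ≟F q ⊎-dec i ≟F r)

sorted : ∀ {size} p q r → {True (enumerates? p q r)} →
         size p ≤ size q → size q ≤ size r → SortedEnumeration size
sorted p q r {valid} p≤q q≤r =
  let (p≢q , p≢r , q≢r) , cover = toWitness valid
  in record { p₁ = p ; p₂ = q ; p₃ = r ; p₁≢p₂ = p≢q ; p₁≢p₃ = p≢r ; p₂≢p₃ = q≢r
            ; cover = cover ; size₁≤size₂ = p≤q ; size₂≤size₃ = q≤r }

sortFin3 : (size : Fin 3 → ℕ) → SortedEnumeration size
sortFin3 size with ≤-total (size zero) (size (suc zero))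
                 | ≤-total (size (suc zero)) (size (suc (suc zero)))
                 | ≤-total (size zero) (size (suc (suc zero)))
... | inj₁ s₀≤s₁ | inj₁ s₁≤s₂ | _          = sorted zero (suc zero) (suc (suc zero)) s₀≤s₁ s₁≤s₂
... | inj₁ s₀≤s₁ | inj₂ s₂≤s₁ | inj₁ s₀≤s₂ = sorted zero (suc (suc zero)) (suc zero) s₀≤s₂ s₂≤s₁
... | inj₁ s₀≤s₁ | inj₂ s₂≤s₁ | inj₂ s₂≤s₀ = sorted (suc (suc zero)) zero (suc zero) s₂≤s₀ s₀≤s₁
... | inj₂ s₁≤s₀ | inj₁ s₁≤s₂ | inj₁ s₀≤s₂ = sorted (suc zero) zero (suc (suc zero)) s₁≤s₀ s₀≤s₂
... | inj₂ s₁≤s₀ | inj₁ s₁≤s₂ | inj₂ s₂≤s₀ = sorted (suc zero) (suc (suc zero)) zero s₁≤s₂ s₂≤s₀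
... | inj₂ s₁≤s₀ | inj₂ s₂≤s₁ | _          = sorted (suc (suc zero)) (suc zero) zero s₂≤s₁ s₁≤s₀

module ThreeCliqueColouring
  {n} (G : SimpleGraph n) (part : Fin n → Fin 3) (condA : CondA G part) (condB : CondB G part)
  (L : Fin 3 → List ℕ) (uniqueL : ∀ i → Unique (L i)) (fits : ∀ i → length (Part part i) ≤ length (L i))
  (d : Fin 3 → ℕ) (d∈L : ∀ i → d i ∈ L i) (d-distinct : ∀ i j → i ≢ j → d i ≢ d j)
  (noCommon : ∀ c → ¬ (∀ i → c ∈ L i))
  (order : SortedEnumeration (λ i → length (L i))) where

  open SortedEnumeration order
  open PartColouring

  notInAllThree : ∀ {c} → c ∈ L p₁ → c ∈ L p₂ → c ∈ L p₃ → ⊥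
  notInAllThree {c} c∈₁ c∈₂ c∈₃ = noCommon c λ i → inList i (cover i)
    where
      inList : ∀ i → i ≡ p₁ ⊎ i ≡ p₂ ⊎ i ≡ p₃ → c ∈ L i
      inList _ (inj₁ refl)        = c∈₁
      inList _ (inj₂ (inj₁ refl)) = c∈₂
      inList _ (inj₂ (inj₂ refl)) = c∈₃

  short₁ : length (L p₂) ≤ 1 → length (L p₁) ≤ 1
  short₁ = ≤-trans size₁≤size₂

  short₂ : length (L p₃) ≤ 1 → length (L p₂) ≤ 1
  short₂ = ≤-trans size₂≤size₃

  apart : ∀ {u v i j} → part u ≡ i → part v ≡ j → i ≢ j → part u ≢ part v
  apart u∈ v∈ i≢j e = i≢j (trans (≡-sym u∈) (trans e v∈))

  outside : ∀ {v i j} → part v ≡ i → i ≢ j → part v ≢ j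
  outside v∈ i≢j e = i≢j (trans (≡-sym v∈) e)

  NbrIn : Fin 3 → (Fin n → Set) → Fin n → Set
  NbrIn j Q w = Σ (Fin n) λ u → part u ≡ j × Adj G u w × Q u

  nbrIn? : ∀ j {Q : Fin n → Set} → (∀ u → Dec (Q u)) → ∀ w → Dec (NbrIn j Q w)
  nbrIn? j Q? w = anyFin? (λ u → part u ≟F j ×-dec adj? G u w ×-dec Q? u)

  Sees : Fin 3 → (Fin n → ℕ) → Fin n → ℕ → Set
  Sees j κ w c = NbrIn j (λ u → κ u ≡ c) w

  oneNbr : ∀ {w j u u'} → part w ≢ j → part u ≡ j → part u' ≡ j → Adj G u w → Adj G u' w → u ≡ u'
  oneNbr w∉j u∈ u'∈ uw u'w =
    condA _ _ _ (λ w≡u → w∉j (trans w≡u u∈)) (trans u∈ (≡-sym u'∈)) (sym G uw) (sym G u'w)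

  module _ {j F} (K : PartColouring part L j F) where

    seen∈L : ∀ {w c} → Sees j (colour K) w c → c ∈ L j
    seen∈L (u , u∈ , _ , refl) = colour∈L K u∈

    seesOne : ∀ {w c c'} → part w ≢ j → Sees j (colour K) w c → Sees j (colour K) w c' → c ≡ c'
    seesOne w∉j (u , u∈ , uw , refl) (u' , u'∈ , u'w , refl) = cong (colour K) (oneNbr w∉j u∈ u'∈ uw u'w)

    seenOnce : ∀ {w w' c} → part w ≢ j → part w ≡ part w' →
               Sees j (colour K) w c → Sees j (colour K) w' c → w ≡ w'
    seenOnce w∉j same (u , u∈ , uw , refl) (u' , u'∈ , u'w , e) =
      condA u _ _ (λ u≡w → w∉j (trans (≡-sym u≡w) u∈)) same uw
        (subst (λ z → Adj G z _) (injective K u'∈ u∈ e) u'w)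

  Never : Fin n → ℕ → Set
  Never _ _ = ⊥

  first : PartColouring part L p₁ Never
  first = colourPart part L p₁ (uniqueL p₁) (fits p₁) Never (λ _ _ → no λ ())
            (λ _ _ _ ()) (λ _ → d p₁ , d∈L p₁ , λ ())

  colour₁ : Fin n → ℕ
  colour₁ = colour first

  -- Phase 2: w ∈ Q₂ avoids its Q₁-neighbour's colour and, when |L₃| ≤ 2, every
  -- colour of L₃ if a Q₃-neighbour v of w already sees a colour of L₃ in Q₁
  -- (else v could find both colours of L₃ taken).
  Reserved : Fin n → ℕ → Set
  Reserved w c = length (L p₃) ≤ 2 × c ∈ L p₃ × NbrIn p₃ (NbrIn p₁ (λ u → colour₁ u ∈ L p₃)) w

  Forbidden₂ : Fin n → ℕ → Set
  Forbidden₂ w c = Sees p₁ colour₁ w c ⊎ Reserved w c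

  forbidden₂? : ∀ w c → Dec (Forbidden₂ w c)
  forbidden₂? w c = nbrIn? p₁ (λ u → colour₁ u ≟ℕ c) w
                    ⊎-dec length (L p₃) ≤? 2 ×-dec c ∈? L p₃
                          ×-dec nbrIn? p₃ (nbrIn? p₁ (λ u → colour₁ u ∈? L p₃)) w

  colour₁Avoids : ∀ {u c} → part u ≡ p₁ → c ∈ L p₂ → c ∈ L p₃ → colour₁ u ≢ c
  colour₁Avoids u∈ c∈₂ c∈₃ refl = notInAllThree (colour∈L first u∈) c∈₂ c∈₃

  seen₁NotShared : ∀ {w c} → Sees p₁ colour₁ w c → c ∈ L p₂ → c ∈ L p₃ → ⊥
  seen₁NotShared (u , u∈ , _ , e) c∈₂ c∈₃ = colour₁Avoids u∈ c∈₂ c∈₃ e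

  -- (b): if w ∈ Q₂ sees a colour of L₂ in Q₁, no colour is reserved at w, since
  -- its Q₁-neighbour would also be the Q₁-neighbour of its Q₃-neighbour
  seenAndReserved : ∀ {w c c'} → part w ≡ p₂ → Sees p₁ colour₁ w c → c ∈ L p₂ → ¬ Reserved w c'
  seenAndReserved {w} w∈ s@(u , u∈ , uw , refl) c∈₂ (_ , _ , v , v∈ , vw , u' , u'∈ , u'v , u'∈₃) =
    seen₁NotShared s c∈₂ (subst (λ z → colour₁ z ∈ L p₃) (≡-sym u≡u') u'∈₃)
    where
      uv : Adj G u v
      uv = condB w u v (apart w∈ u∈ (≢-sym p₁≢p₂)) (apart w∈ v∈ p₂≢p₃) (apart u∈ v∈ p₁≢p₃)
                 (sym G uw) (sym G vw)
      u≡u' : u ≡ u'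
      u≡u' = oneNbr (outside v∈ (≢-sym p₁≢p₃)) u∈ u'∈ uv u'v

  -- a colour c ∈ L₂ is reserved at most once: L₃ holds c and the colours of
  -- the Q₁-vertices involved, which differ from c, so by |L₃| ≤ 2 these
  -- Q₁-vertices, their Q₃-neighbours and finally the Q₂-vertices coincide
  reservedOnce : ∀ {w w' c} → part w ≡ p₂ → part w' ≡ p₂ → c ∈ L p₂ →
                 Reserved w c → Reserved w' c → w ≡ w'
  reservedOnce {w} {w'} w∈ w'∈ c∈₂ (short , c∈₃ , v , v∈ , vw , u , u∈ , uv , u∈₃)
                                   (_ , _ , v' , v'∈ , v'w' , u' , u'∈ , u'v' , u'∈₃) =
    oneNbr (outside v∈ (≢-sym p₂≢p₃)) w∈ w'∈ (sym G vw) (subst (Adj G w') (≡-sym v≡v') (sym G v'w'))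
    where
      u≡u' : u ≡ u'
      u≡u' = injective first u∈ u'∈
               (coincide short u∈₃ u'∈₃ c∈₃ (colour₁Avoids u∈ c∈₂ c∈₃) (colour₁Avoids u'∈ c∈₂ c∈₃))
      v≡v' : v ≡ v'
      v≡v' = oneNbr (outside u∈ p₁≢p₃) v∈ v'∈ (sym G uv) (subst (Adj G v') (≡-sym u≡u') (sym G u'v'))

  oneVictim₂ : ∀ {c w w'} → c ∈ L p₂ → part w ≡ p₂ → part w' ≡ p₂ →
               Forbidden₂ w c → Forbidden₂ w' c → w ≡ w'
  oneVictim₂ _   w∈ w'∈ (inj₁ s) (inj₁ s') =
    seenOnce first (outside w∈ (≢-sym p₁≢p₂)) (trans w∈ (≡-sym w'∈)) s s'
  oneVictim₂ c∈₂ _  _   (inj₁ s) (inj₂ (_ , c∈₃ , _)) = ⊥-elim (seen₁NotShared s c∈₂ c∈₃)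
  oneVictim₂ c∈₂ _  _   (inj₂ (_ , c∈₃ , _)) (inj₁ s) = ⊥-elim (seen₁NotShared s c∈₂ c∈₃)
  oneVictim₂ c∈₂ w∈ w'∈ (inj₂ r) (inj₂ r') = reservedOnce w∈ w'∈ c∈₂ r r'

  -- at most one colour of L₂ is forbidden for w ∈ Q₂; reserved colours differ
  -- from the colour in L₃ seen by the Q₃-neighbour, so there is one by |L₃| ≤ 2
  oneForbidden₂ : ∀ {w c c'} → part w ≡ p₂ → c ∈ L p₂ → c' ∈ L p₂ →
                  Forbidden₂ w c → Forbidden₂ w c' → c ≡ c'
  oneForbidden₂ w∈ _   _    (inj₁ s) (inj₁ s') = seesOne first (outside w∈ (≢-sym p₁≢p₂)) s s'
  oneForbidden₂ w∈ c∈₂ _    (inj₁ s) (inj₂ r)  = ⊥-elim (seenAndReserved w∈ s c∈₂ r)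
  oneForbidden₂ w∈ _   c'∈₂ (inj₂ r) (inj₁ s)  = ⊥-elim (seenAndReserved w∈ s c'∈₂ r)
  oneForbidden₂ _  c∈₂ c'∈₂ (inj₂ (short , c∈₃ , _ , _ , _ , u , u∈ , _ , u∈₃)) (inj₂ (_ , c'∈₃ , _)) =
    coincide short c∈₃ c'∈₃ u∈₃ (≢-sym (colour₁Avoids u∈ c∈₂ c∈₃)) (≢-sym (colour₁Avoids u∈ c'∈₂ c'∈₃))

  d₂Allowed : ∀ {w} → length (L p₂) ≤ 1 → ¬ Forbidden₂ w (d p₂)
  d₂Allowed short (inj₁ s) =
    d-distinct p₁ p₂ p₁≢p₂ (atMostOneMember (short₁ short) (d∈L p₁) (seen∈L first s))
  d₂Allowed short (inj₂ (short₃ , d₂∈₃ , _ , _ , _ , u , u∈ , _ , u∈₃)) =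
    d-distinct p₁ p₂ p₁≢p₂
      (coincide short₃ d₁∈₃ d₂∈₃ (d∈L p₃) (d-distinct p₁ p₃ p₁≢p₃) (d-distinct p₂ p₃ p₂≢p₃))
    where
      d₁∈₃ : d p₁ ∈ L p₃
      d₁∈₃ = subst (_∈ L p₃) (atMostOneMember (short₁ short) (colour∈L first u∈) (d∈L p₁)) u∈₃

  allowed₂ : ∀ {w} → part w ≡ p₂ → Σ ℕ λ c → c ∈ L p₂ × ¬ Forbidden₂ w c
  allowed₂ {w} w∈ with 2 ≤? length (L p₂)
  ... | yes long = avoidOne (forbidden₂? w) (uniqueL p₂) long (oneForbidden₂ w∈)
  ... | no ¬long = d p₂ , d∈L p₂ , d₂Allowed (≤-pred (≰⇒> ¬long))

  second : PartColouring part L p₂ Forbidden₂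
  second = colourPart part L p₂ (uniqueL p₂) (fits p₂) Forbidden₂ forbidden₂? oneVictim₂ allowed₂

  colour₂ : Fin n → ℕ
  colour₂ = colour second

  Forbidden₃ : Fin n → ℕ → Set
  Forbidden₃ v c = Sees p₁ colour₁ v c ⊎ Sees p₂ colour₂ v c

  forbidden₃? : ∀ v c → Dec (Forbidden₃ v c)
  forbidden₃? v c = nbrIn? p₁ (λ u → colour₁ u ≟ℕ c) v ⊎-dec nbrIn? p₂ (λ w → colour₂ w ≟ℕ c) v

  oneVictim₃ : ∀ {c v v'} → c ∈ L p₃ → part v ≡ p₃ → part v' ≡ p₃ →
               Forbidden₃ v c → Forbidden₃ v' c → v ≡ v'
  oneVictim₃ _ v∈ v'∈ (inj₁ s) (inj₁ s') =
    seenOnce first (outside v∈ (≢-sym p₁≢p₃)) (trans v∈ (≡-sym v'∈)) s s'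
  oneVictim₃ _ v∈ v'∈ (inj₂ s) (inj₂ s') =
    seenOnce second (outside v∈ (≢-sym p₂≢p₃)) (trans v∈ (≡-sym v'∈)) s s'
  oneVictim₃ c∈₃ _ _ (inj₁ s) (inj₂ s') = ⊥-elim (notInAllThree (seen∈L first s) (seen∈L second s') c∈₃)
  oneVictim₃ c∈₃ _ _ (inj₂ s) (inj₁ s') = ⊥-elim (notInAllThree (seen∈L first s') (seen∈L second s) c∈₃)

  -- the reservation at work: when |L₃| ≤ 2, no v ∈ Q₃ sees colours of L₃ in
  -- both Q₁ and Q₂, as the Q₂-neighbour had to avoid L₃
  notSeenTwice : ∀ {v c c'} → part v ≡ p₃ → length (L p₃) ≤ 2 →
                 Sees p₁ colour₁ v c → Sees p₂ colour₂ v c' → c ∈ L p₃ → c' ∈ L p₃ → ⊥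
  notSeenTwice {v} v∈ short (u , u∈ , uv , refl) (w , w∈ , wv , refl) c∈₃ c'∈₃ =
    allowed second w∈ (inj₂ (short , c'∈₃ , v , v∈ , sym G wv , u , u∈ , uv , c∈₃))

  oneForbidden₃ : ∀ {v c c'} → part v ≡ p₃ → length (L p₃) ≤ 2 → c ∈ L p₃ → c' ∈ L p₃ →
                  Forbidden₃ v c → Forbidden₃ v c' → c ≡ c'
  oneForbidden₃ v∈ _ _ _ (inj₁ s) (inj₁ s') = seesOne first (outside v∈ (≢-sym p₁≢p₃)) s s'
  oneForbidden₃ v∈ _ _ _ (inj₂ s) (inj₂ s') = seesOne second (outside v∈ (≢-sym p₂≢p₃)) s s'
  oneForbidden₃ v∈ short c∈ c'∈ (inj₁ s) (inj₂ s') = ⊥-elim (notSeenTwice v∈ short s s' c∈ c'∈)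
  oneForbidden₃ v∈ short c∈ c'∈ (inj₂ s) (inj₁ s') = ⊥-elim (notSeenTwice v∈ short s' s c'∈ c∈)

  d₃Allowed : ∀ {v} → length (L p₃) ≤ 1 → ¬ Forbidden₃ v (d p₃)
  d₃Allowed short (inj₁ s) =
    d-distinct p₁ p₃ p₁≢p₃ (atMostOneMember (short₁ (short₂ short)) (d∈L p₁) (seen∈L first s))
  d₃Allowed short (inj₂ s) =
    d-distinct p₂ p₃ p₂≢p₃ (atMostOneMember (short₂ short) (d∈L p₂) (seen∈L second s))

  allowed₃ : ∀ {v} → part v ≡ p₃ → Σ ℕ λ c → c ∈ L p₃ × ¬ Forbidden₃ v c
  allowed₃ {v} v∈ with 3 ≤? length (L p₃)
  ... | yes long = avoidTwo (λ c → nbrIn? p₁ (λ u → colour₁ u ≟ℕ c) v)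
                            (λ c → nbrIn? p₂ (λ w → colour₂ w ≟ℕ c) v) (uniqueL p₃) long
                            (seesOne first (outside v∈ (≢-sym p₁≢p₃)))
                            (seesOne second (outside v∈ (≢-sym p₂≢p₃)))
  ... | no ¬long with 2 ≤? length (L p₃)
  ...   | yes long = avoidOne (forbidden₃? v) (uniqueL p₃) long
                              (oneForbidden₃ v∈ (≤-pred (≰⇒> ¬long)))
  ...   | no ¬long' = d p₃ , d∈L p₃ , d₃Allowed (≤-pred (≰⇒> ¬long'))

  third : PartColouring part L p₃ Forbidden₃
  third = colourPart part L p₃ (uniqueL p₃) (fits p₃) Forbidden₃ forbidden₃? oneVictim₃ allowed₃

  colour₃ : Fin n → ℕ
  colour₃ = colour third

  colourBy : ∀ v → part v ≡ p₁ ⊎ part v ≡ p₂ ⊎ part v ≡ p₃ → ℕ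
  colourBy v (inj₁ _)        = colour₁ v
  colourBy v (inj₂ (inj₁ _)) = colour₂ v
  colourBy v (inj₂ (inj₂ _)) = colour₃ v

  colourBy∈L : ∀ v (v∈ : part v ≡ p₁ ⊎ part v ≡ p₂ ⊎ part v ≡ p₃) → colourBy v v∈ ∈ L (part v)
  colourBy∈L v (inj₁ v∈)        rewrite v∈ = colour∈L first v∈
  colourBy∈L v (inj₂ (inj₁ v∈)) rewrite v∈ = colour∈L second v∈
  colourBy∈L v (inj₂ (inj₂ v∈)) rewrite v∈ = colour∈L third v∈

  injectiveProper : ∀ {i F} (K : PartColouring part L i F) {u v} → part u ≡ i → part v ≡ i →
                    Adj G u v → colour K u ≢ colour K v
  injectiveProper K u∈ v∈ uv e = irrefl G (subst (Adj G _) (≡-sym (injective K u∈ v∈ e)) uv)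

  -- adjacent vertices of different parts: the later part avoided the earlier colour
  colourBy-proper : ∀ {u v} (u∈ : part u ≡ p₁ ⊎ part u ≡ p₂ ⊎ part u ≡ p₃)
                    (v∈ : part v ≡ p₁ ⊎ part v ≡ p₂ ⊎ part v ≡ p₃) →
                    Adj G u v → colourBy u u∈ ≢ colourBy v v∈
  colourBy-proper (inj₁ u∈)        (inj₁ v∈)        uv = injectiveProper first u∈ v∈ uv
  colourBy-proper (inj₂ (inj₁ u∈)) (inj₂ (inj₁ v∈)) uv = injectiveProper second u∈ v∈ uv
  colourBy-proper (inj₂ (inj₂ u∈)) (inj₂ (inj₂ v∈)) uv = injectiveProper third u∈ v∈ uv
  colourBy-proper (inj₁ u∈) (inj₂ (inj₁ v∈)) uv e = allowed second v∈ (inj₁ (_ , u∈ , uv , e))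
  colourBy-proper (inj₁ u∈) (inj₂ (inj₂ v∈)) uv e = allowed third v∈ (inj₁ (_ , u∈ , uv , e))
  colourBy-proper (inj₂ (inj₁ u∈)) (inj₂ (inj₂ v∈)) uv e = allowed third v∈ (inj₂ (_ , u∈ , uv , e))
  colourBy-proper (inj₂ (inj₁ u∈)) (inj₁ v∈) uv e =
    allowed second u∈ (inj₁ (_ , v∈ , sym G uv , ≡-sym e))
  colourBy-proper (inj₂ (inj₂ u∈)) (inj₁ v∈) uv e =
    allowed third u∈ (inj₁ (_ , v∈ , sym G uv , ≡-sym e))
  colourBy-proper (inj₂ (inj₂ u∈)) (inj₂ (inj₁ v∈)) uv e =
    allowed third u∈ (inj₂ (_ , v∈ , sym G uv , ≡-sym e))

  colouring : LColoring G part L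
  colouring = (λ v → colourBy v (cover (part v)))
            , (λ v → colourBy∈L v (cover (part v)))
            , (λ u v → colourBy-proper (cover (part u)) (cover (part v)))

lemma2 : ∀ {n} (G : SimpleGraph n) (part : Fin n → Fin 3) →
         PartsAreCliques G part →
         CondA G part →
         CondB G part →
         (L : Fin 3 → List ℕ) →
         (∀ i → Unique (L i)) →
         (∀ i → length (Part part i) ≤ length (L i)) →
         (d : Fin 3 → ℕ) →
         (∀ i → d i ∈ L i) →
         (∀ i j → i ≢ j → d i ≢ d j) →
         (∀ c → c ∈ L zero → c ∈ L (suc zero) → c ∈ L (suc (suc zero)) → ⊥) →
         LColoring G part L
lemma2 G part _ condA condB L uniqueL fits d d∈L d-distinct noTriple =
  ThreeCliqueColouring.colouring G part condA condB L uniqueL fits d d∈L d-distinct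
    noCommon (sortFin3 (λ i → length (L i)))
  where
    noCommon : ∀ c → ¬ (∀ i → c ∈ L i)
    noCommon c c∈L = noTriple c (c∈L zero) (c∈L (suc zero)) (c∈L (suc (suc zero)))
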